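{- There exists $n_0$ such that for all $n\ge n_0$ the following holds. Let $H$ be an $n$-vertex $3$-uniform hypergraph with $\delta(H)\ge 0.799\binom{n-1}{2}$. Then for all pairs $e=u_0u_1$ and $f=v_0v_1$ of vertices with $\deg_H(u_0,u_1)\ge 0.33(n-2)$, $\deg_H(v_0,v_1)\ge 0.33(n-2)$ and $e\cap f=\emptyset$, there exists a tight path in $H$ of length $12$ connecting the endpairs $(u_0,u_1)$ and $(v_0,v_1)$.
   Context: For a $3$-graph $H$, $\delta(H)$ is the minimum over vertices $v$ of the number of edges containing $v$, and $\deg_H(u,v)$ is the number of edges containing both $u$ and $v$. A tight path in $H$ with vertices $v_1,\dots,v_t$ ($t\ge 3$, all distinct) is the sequence of $t-2$ edges $\{v_1,v_2,v_3\},\{v_2,v_3,v_4\},\dots,\{v_{t-2},v_{t-1},v_t\}$, all of which belong to $H$; its length is its number of edges $t-2$, and its endpairs are the ordered pairs $(v_1,v_2)$ and $(v_t,v_{t-1})$; the path is said to connect its endpairs. -}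

module Defs where

open import Data.Nat using (ℕ; zero; suc; _+_; _∸_; _<ᵇ_)
open import Data.Bool using (Bool; true; false; if_then_else_; _∧_)
open import Data.Fin using (Fin; toℕ) renaming (zero to fz; suc to fs)
open import Data.List using (List; []; _∷_; length)
open import Data.List.Relation.Unary.Unique.Propositional using (Unique)
open import Data.Unit using (⊤)
open import Data.Product using (_×_)
open import Relation.Binary.PropositionalEquality using (_≡_)

-- A 3-uniform hypergraph on vertex set Fin n, given by its (symmetric,
-- loop-free) edge indicator on ordered triples: edge a b c ≡ true iff
-- {a,b,c} is an edge (a 3-element set).
record Graph3 (n : ℕ) : Set where
  field
    edge    : Fin n → Fin n → Fin n → Bool
    sym₁₂   : ∀ a b c → edge a b c ≡ edge b a c
    sym₂₃   : ∀ a b c → edge a b c ≡ edge a c b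
    loopless : ∀ a c → edge a a c ≡ false
open Graph3 public

count : ∀ {n} → (Fin n → Bool) → ℕ
count {zero}  f = 0
count {suc n} f = (if f fz then 1 else 0) + count (λ i → f (fs i))

sumF : ∀ {n} → (Fin n → ℕ) → ℕ
sumF {zero}  f = 0
sumF {suc n} f = f fz + sumF (λ i → f (fs i))

vdeg : ∀ {n} → Graph3 n → Fin n → ℕ
vdeg H v = sumF (λ a → count (λ b → (toℕ a <ᵇ toℕ b) ∧ edge H v a b))

pdeg : ∀ {n} → Graph3 n → Fin n → Fin n → ℕ
pdeg H u v = count (λ w → edge H u v w)

Consecutive : ∀ {n} → Graph3 n → List (Fin n) → Set
Consecutive H (a ∷ b ∷ c ∷ rest) = (edge H a b c ≡ true) × Consecutive H (b ∷ c ∷ rest)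
Consecutive H _ = ⊤

-- vertex sequence v₁ … v_t (t ≥ 3, all distinct) forming a tight path in H;
-- its length is t ∸ 2
IsTightPath : ∀ {n} → Graph3 n → List (Fin n) → Set
IsTightPath H vs = (3 Data.Nat.≤ length vs) × Unique vs × Consecutive H vs

module Submission where

-- Every vertex b satisfies Σ_c deg(b,c) = 2·deg(b) ≥ 0.799·n² (up to O(n)), so by Markov's
-- inequality about a (0.799 − q)/(1 − q) fraction of the vertices c have deg(b,c) ≥ q·n.
-- Hence if deg(a,b) ≥ p·n with p·(1 − q) > 0.201, some c outside any fixed set of 14 vertices
-- has abc ∈ H and deg(b,c) ≥ q·n. Four such steps, 0.33 → 0.375 → 0.46 → 0.56 → 0.637, grow
-- each given pair into a tight path with four new vertices ending in a pair of codegree ≥ 0.637·n.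
-- Two end pairs (a,b) and (c,d) are then joined by x ∈ N(a,b) and y ∈ N(c,d) with bxy, dxy ∈ H:
-- Σ_{x ∈ N(a,b)} |N(c,d) ∩ N(b,x) ∩ N(d,x)| ≥ |N(a,b)|·|N(c,d)| + Σ_x deg(b,x) + Σ_x deg(d,x) − 2n²,
-- which is positive because 0.637² + 2·0.799 > 2.

open import Defs
open import Data.Nat using (ℕ; zero; suc; _+_; _*_; _∸_; _≤_; _<_; z≤n; s≤s; _<ᵇ_; _≤?_; NonZero; >-nonZero)
open import Data.Nat.Properties hiding (_≟_)
open import Data.Nat.Combinatorics using (_C_; nCk+nC[k+1]≡[n+1]C[k+1]; nC1≡n)
open import Data.Nat.Tactic.RingSolver using (solve-∀)
open import Data.Bool using (Bool; true; false; if_then_else_; _∧_; not)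
open import Data.Bool.Properties using (∧-conicalˡ; ∧-conicalʳ; ∧-zeroʳ; ∧-identityʳ; T-≡)
open import Data.Fin using (Fin; toℕ) renaming (zero to fz; suc to fs)
open import Data.Fin.Properties using (_≟_)
open import Data.List using (List; []; _∷_; _++_; length; reverse)
open import Data.Bool.ListAction using (all)
open import Data.List.Properties using (reverse-++; ++-assoc)
open import Data.List.Relation.Unary.All using (All; []; _∷_)
open import Data.List.Relation.Unary.AllPairs using ([]; _∷_)
open import Data.List.Relation.Unary.Unique.Propositional using (Unique)
import Data.List.Relation.Binary.Permutation.Setoid as Permutation
import Data.List.Relation.Binary.Permutation.Setoid.Properties as Permutation-Properties
open import Data.Product using (Σ; Σ-syntax; ∃; _×_; _,_)
open import Data.Unit using (tt)
open import Data.Empty using (⊥-elim)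
open import Function using (_∘_; Equivalence)
open import Relation.Nullary.Decidable using (yes; no; ⌊_⌋; ⌊⌋-map′; toWitness; toWitnessFalse)
open import Relation.Binary.PropositionalEquality
open import Algebra.Properties.Semiring.Sum +-*-semiring using (sum; ∑-distrib-+; ∑-comm; *-distribˡ-sum; sum-cong-≗)

𝟙 : Bool → ℕ
𝟙 b = if b then 1 else 0

𝟙≤1 : ∀ b → 𝟙 b ≤ 1
𝟙≤1 true  = ≤-refl
𝟙≤1 false = z≤n

∧-split : ∀ {a b} → a ∧ b ≡ true → a ≡ true × b ≡ true
∧-split h = ∧-conicalˡ _ _ h , ∧-conicalʳ _ _ h

sumF≡sum : ∀ {n} (f : Fin n → ℕ) → sumF f ≡ sum f
sumF≡sum {zero}  f = refl
sumF≡sum {suc n} f = cong (f fz +_) (sumF≡sum (f ∘ fs))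

sum-mono-≤ : ∀ {n} {f g : Fin n → ℕ} → (∀ i → f i ≤ g i) → sum f ≤ sum g
sum-mono-≤ {zero}  f≤g = z≤n
sum-mono-≤ {suc n} f≤g = +-mono-≤ (f≤g fz) (sum-mono-≤ (f≤g ∘ fs))

sum-const : ∀ {n} k → sum {n} (λ _ → k) ≡ n * k
sum-const {zero}  k = refl
sum-const {suc n} k = cong (k +_) (sum-const {n} k)

sum-positive : ∀ {n} (f : Fin n → ℕ) → 0 < sum f → ∃ λ i → 0 < f i
sum-positive {suc n} f 0<sum with f fz in eq
... | suc _ = fz , subst (0 <_) (sym eq) (s≤s z≤n)
... | zero  = let i , 0<fi = sum-positive (f ∘ fs) 0<sum in fs i , 0<fi

count≡∑𝟙 : ∀ {n} (f : Fin n → Bool) → count f ≡ sum (𝟙 ∘ f)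
count≡∑𝟙 {zero}  f = refl
count≡∑𝟙 {suc n} f = cong (𝟙 (f fz) +_) (count≡∑𝟙 (f ∘ fs))

count-cong : ∀ {n} {f g : Fin n → Bool} → (∀ i → f i ≡ g i) → count f ≡ count g
count-cong {f = f} {g} f≗g = trans (count≡∑𝟙 f) (trans (sum-cong-≗ (cong 𝟙 ∘ f≗g)) (sym (count≡∑𝟙 g)))

sum-if : ∀ {n} (f : Fin n → Bool) k → sum (λ i → if f i then k else 0) ≡ count f * k
sum-if {zero}  f k = refl
sum-if {suc n} f k with f fz
... | true  = cong (k +_) (sum-if (f ∘ fs) k)
... | false = sum-if (f ∘ fs) k

count≤n : ∀ {n} (f : Fin n → Bool) → count f ≤ n
count≤n {zero}  f = z≤n
count≤n {suc n} f with f fz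
... | true  = s≤s (count≤n (f ∘ fs))
... | false = m≤n⇒m≤1+n (count≤n (f ∘ fs))

count-witness : ∀ {n} (f : Fin n → Bool) → 0 < count f → ∃ λ i → f i ≡ true
count-witness {suc n} f 0<count with f fz in eq
... | true  = fz , eq
... | false = let i , fi = count-witness (f ∘ fs) 0<count in fs i , fi

count-∧ : ∀ {n} (f g : Fin n → Bool) → count f + count g ≤ count (λ i → f i ∧ g i) + n
count-∧ {n} f g = begin
  count f + count g                     ≡⟨ cong₂ _+_ (count≡∑𝟙 f) (count≡∑𝟙 g) ⟩
  sum (𝟙 ∘ f) + sum (𝟙 ∘ g)             ≡⟨ ∑-distrib-+ (𝟙 ∘ f) (𝟙 ∘ g) ⟨
  sum (λ i → 𝟙 (f i) + 𝟙 (g i))         ≤⟨ sum-mono-≤ (λ i → 𝟙-∧ (f i) (g i)) ⟩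
  sum (λ i → 𝟙 (f i ∧ g i) + 1)         ≡⟨ ∑-distrib-+ (λ i → 𝟙 (f i ∧ g i)) (λ _ → 1) ⟩
  sum (λ i → 𝟙 (f i ∧ g i)) + sum {n} (λ _ → 1)
    ≡⟨ cong₂ _+_ (sym (count≡∑𝟙 (λ i → f i ∧ g i))) (trans (sum-const {n} 1) (*-identityʳ n)) ⟩
  count (λ i → f i ∧ g i) + n           ∎
  where
  open ≤-Reasoning
  𝟙-∧ : ∀ a b → 𝟙 a + 𝟙 b ≤ 𝟙 (a ∧ b) + 1
  𝟙-∧ true  b     = ≤-reflexive (+-comm 1 (𝟙 b))
  𝟙-∧ false true  = ≤-refl
  𝟙-∧ false false = z≤n

count-punch : ∀ {n} (f g : Fin n → Bool) (u : Fin n) →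
              count (λ i → f i ∧ g i) ≤ suc (count (λ i → f i ∧ (not ⌊ u ≟ i ⌋ ∧ g i)))
count-punch {suc n} f g fz rewrite ∧-zeroʳ (f fz) =
  +-monoˡ-≤ (count (λ i → f (fs i) ∧ g (fs i))) (𝟙≤1 (f fz ∧ g fz))
count-punch {suc n} f g (fs u) = begin
  a + count (λ i → f (fs i) ∧ g (fs i))               ≤⟨ +-monoʳ-≤ a (count-punch (f ∘ fs) (g ∘ fs) u) ⟩
  a + suc (count (λ i → f (fs i) ∧ (not ⌊ u ≟ i ⌋ ∧ g (fs i))))
    ≡⟨ +-suc a _ ⟩
  suc (a + count (λ i → f (fs i) ∧ (not ⌊ u ≟ i ⌋ ∧ g (fs i))))
    ≡⟨ cong (λ c → suc (a + c)) (count-cong λ i → cong (λ b → f (fs i) ∧ (not b ∧ g (fs i))) (⌊⌋-map′ _ _ (u ≟ i))) ⟨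
  suc (a + count (λ i → f (fs i) ∧ (not ⌊ fs u ≟ fs i ⌋ ∧ g (fs i)))) ∎
  where
  open ≤-Reasoning
  a = 𝟙 (f fz ∧ g fz)

outside : ∀ {n} → List (Fin n) → Fin n → Bool
outside U i = all (λ u → not ⌊ u ≟ i ⌋) U

outside⇒All≢ : ∀ {n} (U : List (Fin n)) {i} → outside U i ≡ true → All (i ≢_) U
outside⇒All≢ []      _ = []
outside⇒All≢ (u ∷ U) h =
  let u≠i , rest = ∧-split h
  in ≢-sym (toWitnessFalse (Equivalence.from T-≡ u≠i)) ∷ outside⇒All≢ U rest

count-outside : ∀ {n} (f : Fin n → Bool) (U : List (Fin n)) →
                count f ≤ count (λ i → f i ∧ outside U i) + length U
count-outside f [] = ≤-reflexive (trans (count-cong λ i → sym (∧-identityʳ (f i))) (sym (+-identityʳ _)))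
count-outside f (u ∷ U) = begin
  count f                                            ≤⟨ count-outside f U ⟩
  count (λ i → f i ∧ outside U i) + length U         ≤⟨ +-monoˡ-≤ (length U) (count-punch f (outside U) u) ⟩
  suc (count (λ i → f i ∧ outside (u ∷ U) i)) + length U ≡⟨ +-suc _ _ ⟨
  count (λ i → f i ∧ outside (u ∷ U) i) + suc (length U) ∎
  where open ≤-Reasoning

sum-markov : ∀ {n} (f : Fin n → ℕ) {s t} → (∀ i → f i ≤ s + t) →
             sum f ≤ count (λ i → ⌊ t ≤? f i ⌋) * s + n * t
sum-markov {n} f {s} {t} f≤s+t = begin
  sum f                                              ≤⟨ sum-mono-≤ split ⟩
  sum (λ i → (if ⌊ t ≤? f i ⌋ then s else 0) + t)    ≡⟨ ∑-distrib-+ (λ i → if ⌊ t ≤? f i ⌋ then s else 0) (λ _ → t) ⟩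
  sum (λ i → if ⌊ t ≤? f i ⌋ then s else 0) + sum {n} (λ _ → t)
    ≡⟨ cong₂ _+_ (sum-if (λ i → ⌊ t ≤? f i ⌋) s) (sum-const {n} t) ⟩
  count (λ i → ⌊ t ≤? f i ⌋) * s + n * t             ∎
  where
  open ≤-Reasoning
  split : ∀ i → f i ≤ (if ⌊ t ≤? f i ⌋ then s else 0) + t
  split i with t ≤? f i
  ... | yes _   = f≤s+t i
  ... | no  t≰f = <⇒≤ (≰⇒> t≰f)

module _ {n : ℕ} where
  open Permutation (setoid (Fin n)) using (↭-trans; ↭-sym)
  open Permutation-Properties (setoid (Fin n)) using (Unique-resp-↭; ++-comm; ++⁺ʳ; ↭-reverse)

  Unique-++-comm : ∀ (xs ys : List (Fin n)) → Unique (xs ++ ys) → Unique (ys ++ xs)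
  Unique-++-comm xs ys = Unique-resp-↭ (++-comm xs ys)

  Unique-reverse-++ : ∀ (xs ys : List (Fin n)) → Unique (ys ++ xs) → Unique (reverse xs ++ ys)
  Unique-reverse-++ xs ys = Unique-resp-↭ (↭-trans (++-comm ys xs) (++⁺ʳ ys (↭-sym (↭-reverse xs))))

2*nC2+n≡n*n : ∀ n → 2 * (n C 2) + n ≡ n * n
2*nC2+n≡n*n zero    = refl
2*nC2+n≡n*n (suc n) = begin
  2 * (suc n C 2) + suc n         ≡⟨ cong (λ c → 2 * c + suc n) (nCk+nC[k+1]≡[n+1]C[k+1] n 1) ⟨
  2 * (n C 1 + n C 2) + suc n     ≡⟨ cong (λ c → 2 * (c + n C 2) + suc n) (nC1≡n n) ⟩
  2 * (n + n C 2) + suc n         ≡⟨ regroup n (n C 2) ⟩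
  (2 * (n C 2) + n) + (2 * n + 1) ≡⟨ cong (_+ (2 * n + 1)) (2*nC2+n≡n*n n) ⟩
  n * n + (2 * n + 1)             ≡⟨ square n ⟩
  suc n * suc n                   ∎
  where
  open ≡-Reasoning
  regroup : ∀ n c → 2 * (n + c) + suc n ≡ (2 * c + n) + (2 * n + 1)
  regroup = solve-∀
  square : ∀ n → n * n + (2 * n + 1) ≡ suc n * suc n
  square = solve-∀

module _ {n} (H : Graph3 n) where

  edge-rotate : ∀ a b c → edge H a b c ≡ edge H c a b
  edge-rotate a b c = sym (trans (sym₁₂ H c a b) (sym₂₃ H a c b))

  edge-reverse : ∀ a b c → edge H a b c ≡ edge H c b a
  edge-reverse a b c = trans (sym₁₂ H a b c) (trans (sym₂₃ H b a c) (sym₁₂ H b c a))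

  edge⇒≢ : ∀ {a x y} → edge H a x y ≡ true → x ≢ y
  edge⇒≢ {a} {x} h refl with () ← trans (sym h) (trans (sym₁₂ H a x x) (trans (sym₂₃ H x a x) (loopless H x a)))

  2*vdeg≤∑pdeg : ∀ v → 2 * vdeg H v ≤ sum (pdeg H v)
  2*vdeg≤∑pdeg v = begin
    2 * vdeg H v                                         ≡⟨ cong (vdeg H v +_) (+-identityʳ _) ⟩
    vdeg H v + vdeg H v                                  ≡⟨ cong₂ _+_ vdeg≡∑< vdeg≡∑> ⟩
    sum (λ a → sum (λ b → 𝟙 (a ≺ b ∧ E a b))) + sum (λ a → sum (λ b → 𝟙 (b ≺ a ∧ E a b)))
      ≡⟨ ∑-distrib-+ (λ a → sum (λ b → 𝟙 (a ≺ b ∧ E a b))) (λ a → sum (λ b → 𝟙 (b ≺ a ∧ E a b))) ⟨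
    sum (λ a → sum (λ b → 𝟙 (a ≺ b ∧ E a b)) + sum (λ b → 𝟙 (b ≺ a ∧ E a b)))
      ≡⟨ sum-cong-≗ (λ a → ∑-distrib-+ (λ b → 𝟙 (a ≺ b ∧ E a b)) (λ b → 𝟙 (b ≺ a ∧ E a b))) ⟨
    sum (λ a → sum (λ b → 𝟙 (a ≺ b ∧ E a b) + 𝟙 (b ≺ a ∧ E a b)))
      ≤⟨ sum-mono-≤ (λ a → sum-mono-≤ (λ b → 𝟙-split (toℕ a) (toℕ b) (E a b))) ⟩
    sum (λ a → sum (λ b → 𝟙 (E a b)))                    ≡⟨ sum-cong-≗ (λ a → count≡∑𝟙 (E a)) ⟨
    sum (pdeg H v)                                       ∎
    where
    open ≤-Reasoning
    E : Fin n → Fin n → Bool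
    E = edge H v
    _≺_ : Fin n → Fin n → Bool
    a ≺ b = toℕ a <ᵇ toℕ b
    vdeg≡∑< : vdeg H v ≡ sum (λ a → sum (λ b → 𝟙 (a ≺ b ∧ E a b)))
    vdeg≡∑< = trans (sumF≡sum (λ a → count (λ b → a ≺ b ∧ E a b))) (sum-cong-≗ (λ a → count≡∑𝟙 (λ b → a ≺ b ∧ E a b)))
    vdeg≡∑> : vdeg H v ≡ sum (λ a → sum (λ b → 𝟙 (b ≺ a ∧ E a b)))
    vdeg≡∑> = trans vdeg≡∑< (trans (∑-comm (λ a b → 𝟙 (a ≺ b ∧ E a b)))
                (sum-cong-≗ λ a → sum-cong-≗ λ b → cong (λ e → 𝟙 (b ≺ a ∧ e)) (sym₂₃ H v b a)))
    𝟙-split : ∀ (x y : ℕ) e → 𝟙 ((x <ᵇ y) ∧ e) + 𝟙 ((y <ᵇ x) ∧ e) ≤ 𝟙 e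
    𝟙-split x y e with x <ᵇ y in x<y | y <ᵇ x in y<x
    ... | true  | true  = ⊥-elim (<-asym (<ᵇ⇒< x y (Equivalence.from T-≡ x<y)) (<ᵇ⇒< y x (Equivalence.from T-≡ y<x)))
    ... | true  | false = ≤-reflexive (+-identityʳ (𝟙 e))
    ... | false | true  = ≤-refl
    ... | false | false = z≤n

  Consecutive-++ : ∀ xs {a b ys} → Consecutive H (xs ++ a ∷ b ∷ []) → Consecutive H (a ∷ b ∷ ys) →
                   Consecutive H (xs ++ a ∷ b ∷ ys)
  Consecutive-++ []                 _                 right = right
  Consecutive-++ (x ∷ [])           (xab , _)         right = xab , right
  Consecutive-++ (x ∷ x′ ∷ [])      (xx′a , x′ab , _) right = xx′a , x′ab , right
  Consecutive-++ (x ∷ x′ ∷ x″ ∷ xs) (xx′x″ , left)    right = xx′x″ , Consecutive-++ (x′ ∷ x″ ∷ xs) left right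

  Consecutive-reverse : ∀ xs → Consecutive H xs → Consecutive H (reverse xs)
  Consecutive-reverse []               _ = tt
  Consecutive-reverse (a ∷ [])         _ = tt
  Consecutive-reverse (a ∷ b ∷ [])     _ = tt
  Consecutive-reverse (a ∷ b ∷ c ∷ xs) (abc , rest) =
    subst (Consecutive H) (sym (reverse-++ (a ∷ b ∷ c ∷ []) xs))
      (Consecutive-++ (reverse xs)
        (subst (Consecutive H) (reverse-++ (b ∷ c ∷ []) xs) (Consecutive-reverse (b ∷ c ∷ xs) rest))
        (trans (edge-reverse c b a) abc , tt))

  Consecutive-reverse-++ : ∀ {a b} L ys → Consecutive H (b ∷ a ∷ L) → Consecutive H (a ∷ b ∷ ys) →
                           Consecutive H (reverse (b ∷ a ∷ L) ++ ys)
  Consecutive-reverse-++ {a} {b} L ys left right =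
    subst (Consecutive H) (sym (trans (cong (_++ ys) (reverse-++ (b ∷ a ∷ []) L)) (++-assoc (reverse L) (a ∷ b ∷ []) ys)))
      (Consecutive-++ (reverse L)
        (subst (Consecutive H) (reverse-++ (b ∷ a ∷ []) L) (Consecutive-reverse (b ∷ a ∷ L) left)) right)

  -- P is a tight path listed from the end at which it grows; it shares no vertex with A.
  record PathAvoiding (P A : List (Fin n)) : Set where
    constructor pathAvoiding
    field
      unique      : Unique (P ++ A)
      consecutive : Consecutive H P

  PathAvoiding-swap : ∀ {P a b} → PathAvoiding P (b ∷ a ∷ []) → PathAvoiding (b ∷ a ∷ []) P
  PathAvoiding-swap {P} (pathAvoiding unique _) = pathAvoiding (Unique-++-comm P _ unique) tt

∑pdeg-lower-bound : ∀ {n} (H : Graph3 n) → (∀ v → 799 * ((n ∸ 1) C 2) ≤ 1000 * vdeg H v) →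
                    ∀ b → 799 * n * n ≤ 1000 * sum (pdeg H b) + 2397 * n
∑pdeg-lower-bound {zero}  H δ b = z≤n
∑pdeg-lower-bound {suc m} H δ b = begin
  799 * suc m * suc m                           ≡⟨ expand m ⟩
  799 * (m * m) + 1598 * m + 799                ≡⟨ cong (λ x → 799 * x + 1598 * m + 799) (2*nC2+n≡n*n m) ⟨
  799 * (2 * (m C 2) + m) + 1598 * m + 799      ≡⟨ regroup m (m C 2) ⟩
  2 * (799 * (m C 2)) + 2397 * m + 799          ≤⟨ +-monoˡ-≤ 799 (+-monoˡ-≤ (2397 * m) (*-monoʳ-≤ 2 (δ b))) ⟩
  2 * (1000 * vdeg H b) + 2397 * m + 799        ≡⟨ cong (λ x → x + 2397 * m + 799) (reorder (vdeg H b)) ⟩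
  1000 * (2 * vdeg H b) + 2397 * m + 799        ≤⟨ +-monoˡ-≤ 799 (+-monoˡ-≤ (2397 * m) (*-monoʳ-≤ 1000 (2*vdeg≤∑pdeg H b))) ⟩
  1000 * sum (pdeg H b) + 2397 * m + 799        ≤⟨ +-monoʳ-≤ (1000 * sum (pdeg H b) + 2397 * m) (m≤m+n 799 1598) ⟩
  1000 * sum (pdeg H b) + 2397 * m + 2397       ≡⟨ absorb (1000 * sum (pdeg H b)) m ⟩
  1000 * sum (pdeg H b) + 2397 * suc m          ∎
  where
  open ≤-Reasoning
  expand : ∀ m → 799 * suc m * suc m ≡ 799 * (m * m) + 1598 * m + 799
  expand = solve-∀
  regroup : ∀ m c → 799 * (2 * c + m) + 1598 * m + 799 ≡ 2 * (799 * c) + 2397 * m + 799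
  regroup = solve-∀
  reorder : ∀ d → 2 * (1000 * d) ≡ 1000 * (2 * d)
  reorder = solve-∀
  absorb : ∀ x m → x + 2397 * m + 2397 ≡ x + 2397 * suc m
  absorb = solve-∀

-- deg(a,b) ≥ (p/1000)·n − 0.66; the slack absorbs the n − 2 of the hypothesis 33(n − 2) ≤ 100·deg(a,b).
Heavy : ∀ {n} → Graph3 n → ℕ → Fin n → Fin n → Set
Heavy {n} H p a b = p * n ≤ 1000 * pdeg H a b + 660

Heavy-from-codegree : ∀ {n} (H : Graph3 n) {a b} → 33 * (n ∸ 2) ≤ 100 * pdeg H a b → Heavy H 330 a b
Heavy-from-codegree {zero}        H h = z≤n
Heavy-from-codegree {suc zero}    H {a} {b} h = m≤n⇒m≤o+n (1000 * pdeg H a b) (≤ᵇ⇒≤ 330 660 tt)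
Heavy-from-codegree {suc (suc m)} H {a} {b} h = begin
  330 * suc (suc m)         ≡⟨ split m ⟩
  10 * (33 * m) + 660       ≤⟨ +-monoˡ-≤ 660 (*-monoʳ-≤ 10 h) ⟩
  10 * (100 * pdeg H a b) + 660 ≡⟨ cong (_+ 660) (*-assoc 10 100 (pdeg H a b)) ⟨
  1000 * pdeg H a b + 660   ∎
  where
  open ≤-Reasoning
  split : ∀ m → 330 * suc (suc m) ≡ 10 * (33 * m) + 660
  split = solve-∀

extension-arithmetic : ∀ {n p q r d g} → 100000 ≤ n → q + r ≡ 1000 → 202000 ≤ r * p →
                       p * n ≤ 1000 * d + 660 → 799 * n ≤ r * g + q * n + 2397 → n + 14 < d + g
extension-arithmetic {n} {p} {q} {r} {d} {g} n-large q+r rp heavy markov =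
  ≰⇒> λ d+g≤ → <⇒≱ small-n (+-cancelˡ-≤ (1000000 * n) _ _ (combined d+g≤))
  where
  open ≤-Reasoning
  r≤1000 : r ≤ 1000
  r≤1000 = subst (r ≤_) q+r (m≤n+m r q)
  small-n : 17057000 < 1000 * n
  small-n = ≤-trans (≤ᵇ⇒≤ _ _ tt) (*-monoʳ-≤ 1000 n-large)
  combined : d + g ≤ n + 14 → 1000000 * n + 1000 * n ≤ 1000000 * n + 17057000
  combined d+g≤ = begin
    1000000 * n + 1000 * n                                  ≡⟨ e₁ n ⟩
    202000 * n + 799000 * n                                 ≤⟨ +-monoˡ-≤ (799000 * n) (*-monoˡ-≤ n rp) ⟩
    r * p * n + 799000 * n                                  ≡⟨ e₂ r p n ⟩
    r * (p * n) + 1000 * (799 * n)                          ≤⟨ +-mono-≤ (*-monoʳ-≤ r heavy) (*-monoʳ-≤ 1000 markov) ⟩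
    r * (1000 * d + 660) + 1000 * (r * g + q * n + 2397)    ≡⟨ e₃ r d g q n ⟩
    1000 * r * (d + g) + 660 * r + 1000 * q * n + 2397000
      ≤⟨ +-monoˡ-≤ 2397000 (+-monoˡ-≤ (1000 * q * n) (+-monoˡ-≤ (660 * r) (*-monoʳ-≤ (1000 * r) d+g≤))) ⟩
    1000 * r * (n + 14) + 660 * r + 1000 * q * n + 2397000  ≡⟨ e₄ r n q ⟩
    1000 * (q + r) * n + 14660 * r + 2397000                ≡⟨ cong (λ s → 1000 * s * n + 14660 * r + 2397000) q+r ⟩
    1000 * 1000 * n + 14660 * r + 2397000                   ≤⟨ +-monoˡ-≤ 2397000 (+-monoʳ-≤ (1000 * 1000 * n) (*-monoʳ-≤ 14660 r≤1000)) ⟩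
    1000 * 1000 * n + 14660 * 1000 + 2397000                ≡⟨ e₅ n ⟩
    1000000 * n + 17057000                                  ∎
    where
    e₁ : ∀ n → 1000000 * n + 1000 * n ≡ 202000 * n + 799000 * n
    e₁ = solve-∀
    e₂ : ∀ r p n → r * p * n + 799000 * n ≡ r * (p * n) + 1000 * (799 * n)
    e₂ = solve-∀
    e₃ : ∀ r d g q n → r * (1000 * d + 660) + 1000 * (r * g + q * n + 2397)
                      ≡ 1000 * r * (d + g) + 660 * r + 1000 * q * n + 2397000
    e₃ = solve-∀
    e₄ : ∀ r n q → 1000 * r * (n + 14) + 660 * r + 1000 * q * n + 2397000
                 ≡ 1000 * (q + r) * n + 14660 * r + 2397000
    e₄ = solve-∀
    e₅ : ∀ n → 1000 * 1000 * n + 14660 * 1000 + 2397000 ≡ 1000000 * n + 17057000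
    e₅ = solve-∀

bridge-arithmetic : ∀ {n x y D₁ D₂} → 100000 ≤ n → x ≤ n → y ≤ n →
                    637 * n ≤ 1000 * x + 14660 → 637 * n ≤ 1000 * y + 14660 →
                    799 * n * n ≤ 1000 * D₁ + 2397 * n → 799 * n * n ≤ 1000 * D₂ + 2397 * n →
                    n * (n + n) < x * y + (D₁ + D₂)
bridge-arithmetic {n} {x} {y} {D₁} {D₂} n-large x≤n y≤n hx hy h₁ h₂ =
  ≰⇒> λ xy+D≤ → <⇒≱ small-n (+-cancelˡ-≤ (2000000 * n * n) _ _ (combined xy+D≤))
  where
  open ≤-Reasoning
  small-n : 34114000 * n + 214915600 < 3769 * n * n
  small-n = begin-strict
    34114000 * n + 214915600
      <⟨ +-monoʳ-< (34114000 * n) (<-≤-trans (≤ᵇ⇒≤ _ _ tt) (*-monoʳ-≤ 342786000 n-large)) ⟩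
    34114000 * n + 342786000 * n  ≡⟨ *-distribʳ-+ n 34114000 342786000 ⟨
    3769 * 100000 * n             ≤⟨ *-monoˡ-≤ n (*-monoʳ-≤ 3769 n-large) ⟩
    3769 * n * n                  ∎
  combined : x * y + (D₁ + D₂) ≤ n * (n + n) →
             2000000 * n * n + 3769 * n * n ≤ 2000000 * n * n + (34114000 * n + 214915600)
  combined xy+D≤ = begin
    2000000 * n * n + 3769 * n * n                                  ≡⟨ e₁ n ⟩
    (637 * n) * (637 * n) + 1000 * (799 * n * n + 799 * n * n)
      ≤⟨ +-mono-≤ (*-mono-≤ hx hy) (*-monoʳ-≤ 1000 (+-mono-≤ h₁ h₂)) ⟩
    (1000 * x + 14660) * (1000 * y + 14660) + 1000 * (1000 * D₁ + 2397 * n + (1000 * D₂ + 2397 * n))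
      ≡⟨ e₂ x y D₁ D₂ n ⟩
    1000000 * (x * y + (D₁ + D₂)) + 14660000 * x + 14660000 * y + (4794000 * n + 214915600)
      ≤⟨ +-monoˡ-≤ (4794000 * n + 214915600)
           (+-mono-≤ (+-monoʳ-≤ (1000000 * (x * y + (D₁ + D₂))) (*-monoʳ-≤ 14660000 x≤n)) (*-monoʳ-≤ 14660000 y≤n)) ⟩
    1000000 * (x * y + (D₁ + D₂)) + 14660000 * n + 14660000 * n + (4794000 * n + 214915600)
      ≤⟨ +-monoˡ-≤ (4794000 * n + 214915600) (+-monoˡ-≤ (14660000 * n) (+-monoˡ-≤ (14660000 * n) (*-monoʳ-≤ 1000000 xy+D≤))) ⟩
    1000000 * (n * (n + n)) + 14660000 * n + 14660000 * n + (4794000 * n + 214915600) ≡⟨ e₃ n ⟩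
    2000000 * n * n + (34114000 * n + 214915600)                    ∎
    where
    e₁ : ∀ n → 2000000 * n * n + 3769 * n * n ≡ (637 * n) * (637 * n) + 1000 * (799 * n * n + 799 * n * n)
    e₁ = solve-∀
    e₂ : ∀ x y D₁ D₂ n → (1000 * x + 14660) * (1000 * y + 14660) + 1000 * (1000 * D₁ + 2397 * n + (1000 * D₂ + 2397 * n))
         ≡ 1000000 * (x * y + (D₁ + D₂)) + 14660000 * x + 14660000 * y + (4794000 * n + 214915600)
    e₂ x y D₁ D₂ n = expand x y D₁ D₂ n 1000 14660 2397
      where
      expand : ∀ x y D₁ D₂ n K c t → (K * x + c) * (K * y + c) + K * (K * D₁ + t * n + (K * D₂ + t * n))
               ≡ K * K * (x * y + (D₁ + D₂)) + c * K * x + c * K * y + ((K * t + K * t) * n + c * c)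
      expand = solve-∀
    e₃ : ∀ n → 1000000 * (n * (n + n)) + 14660000 * n + 14660000 * n + (4794000 * n + 214915600)
               ≡ 2000000 * n * n + (34114000 * n + 214915600)
    e₃ n = collect n 1000000 14660000 4794000 214915600
      where
      collect : ∀ n K a b c → K * (n * (n + n)) + a * n + a * n + (b * n + c) ≡ (K + K) * n * n + ((a + a + b) * n + c)
      collect = solve-∀

Heavy-outside : ∀ {n} (H : Graph3 n) {p a b} (U : List (Fin n)) → length U ≤ 14 → Heavy H p a b →
                p * n ≤ 1000 * count (λ x → edge H a b x ∧ outside U x) + 14660
Heavy-outside {n} H {p} {a} {b} U short heavy = begin
  p * n                                ≤⟨ heavy ⟩
  1000 * pdeg H a b + 660              ≤⟨ +-monoˡ-≤ 660 (*-monoʳ-≤ 1000 (≤-trans (count-outside (edge H a b) U) (+-monoʳ-≤ (count X) short))) ⟩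
  1000 * (count X + 14) + 660          ≡⟨ cong (_+ 660) (*-distribˡ-+ 1000 (count X) 14) ⟩
  1000 * count X + 14000 + 660         ≡⟨ +-assoc (1000 * count X) 14000 660 ⟩
  1000 * count X + 14660               ∎
  where
  open ≤-Reasoning
  X : Fin n → Bool
  X x = edge H a b x ∧ outside U x

module Construction {n} (H : Graph3 n) (δ : ∀ v → 799 * ((n ∸ 1) C 2) ≤ 1000 * vdeg H v) (n-large : 100000 ≤ n) where

  instance
    n-nonZero : NonZero n
    n-nonZero = >-nonZero (≤-trans (s≤s z≤n) n-large)

  heavy-neighbours : ∀ q r → q + r ≡ 1000 → ∀ b →
                     799 * n ≤ r * count (λ c → ⌊ q * n ≤? 1000 * pdeg H b c ⌋) + q * n + 2397
  heavy-neighbours q r q+r b = *-cancelˡ-≤ n (begin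
    n * (799 * n)                                 ≡⟨ *-comm n (799 * n) ⟩
    799 * n * n                                   ≤⟨ ∑pdeg-lower-bound H δ b ⟩
    1000 * sum (pdeg H b) + 2397 * n              ≡⟨ cong (_+ 2397 * n) (*-distribˡ-sum 1000 (pdeg H b)) ⟩
    sum (λ c → 1000 * pdeg H b c) + 2397 * n      ≤⟨ +-monoˡ-≤ (2397 * n) (sum-markov (λ c → 1000 * pdeg H b c) bounded) ⟩
    G * (r * n) + n * (q * n) + 2397 * n          ≡⟨ factor-n r n G q ⟩
    n * (r * G + q * n + 2397)                    ∎)
    where
    open ≤-Reasoning
    G = count (λ c → ⌊ q * n ≤? 1000 * pdeg H b c ⌋)
    bounded : ∀ c → 1000 * pdeg H b c ≤ r * n + q * n
    bounded c = begin
      1000 * pdeg H b c   ≤⟨ *-monoʳ-≤ 1000 (count≤n (edge H b c)) ⟩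
      1000 * n            ≡⟨ cong (_* n) {1000} (trans (sym q+r) (+-comm q r)) ⟩
      (r + q) * n         ≡⟨ *-distribʳ-+ n r q ⟩
      r * n + q * n       ∎
    factor-n : ∀ r n G q → G * (r * n) + n * (q * n) + 2397 * n ≡ n * (r * G + q * n + 2397)
    factor-n = solve-∀

  extend : ∀ p q r → q + r ≡ 1000 → 202000 ≤ r * p → ∀ {a b P A} → length (P ++ A) ≤ 12 →
           Heavy H p a b → PathAvoiding H (b ∷ a ∷ P) A →
           Σ[ c ∈ Fin n ] PathAvoiding H (c ∷ b ∷ a ∷ P) A × Heavy H q b c
  extend p q r q+r rp {a} {b} {P} {A} room heavy (pathAvoiding unique consecutive) =
    let c , c-found  = count-witness found found-nonempty
        c-cand , c-U = ∧-split c-found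
        c-E , c-good = ∧-split c-cand
    in c , pathAvoiding (outside⇒All≢ U c-U ∷ unique) (trans (edge-reverse H c b a) c-E , consecutive)
         , m≤n⇒m≤n+o 660 (toWitness (Equivalence.from T-≡ c-good))
    where
    U = b ∷ a ∷ P ++ A
    good : Fin n → Bool
    good c = ⌊ q * n ≤? 1000 * pdeg H b c ⌋
    candidate : Fin n → Bool
    candidate c = edge H a b c ∧ good c
    found : Fin n → Bool
    found c = candidate c ∧ outside U c
    found-nonempty : 0 < count found
    found-nonempty = +-cancelʳ-< (n + 14) 0 (count found) (begin-strict
      n + 14                        <⟨ extension-arithmetic {p = p} {q} {r} {pdeg H a b} {count good}
                                         n-large q+r rp heavy (heavy-neighbours q r q+r b) ⟩
      pdeg H a b + count good       ≤⟨ count-∧ (edge H a b) good ⟩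
      count candidate + n           ≤⟨ +-monoˡ-≤ n (count-outside candidate U) ⟩
      count found + length U + n    ≤⟨ +-monoˡ-≤ n (+-monoʳ-≤ (count found) (s≤s (s≤s room))) ⟩
      count found + 14 + n          ≡⟨ +-assoc (count found) 14 n ⟩
      count found + (14 + n)        ≡⟨ cong (count found +_) (+-comm 14 n) ⟩
      count found + (n + 14)        ∎)
      where open ≤-Reasoning

  walk-to-heavy : ∀ {a b P A} → length (P ++ A) ≤ 9 → Heavy H 330 a b → PathAvoiding H (b ∷ a ∷ P) A →
                Σ[ w₁ ∈ Fin n ] Σ[ w₂ ∈ Fin n ] Σ[ w₃ ∈ Fin n ] Σ[ w₄ ∈ Fin n ]
                  PathAvoiding H (w₄ ∷ w₃ ∷ w₂ ∷ w₁ ∷ b ∷ a ∷ P) A × Heavy H 637 w₃ w₄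
  walk-to-heavy {P = P} {A} short heavy path =
    let w₁ , path₁ , heavy₁ = extend 330 375 625 refl (≤ᵇ⇒≤ _ _ tt) (room 0 z≤n) heavy path
        w₂ , path₂ , heavy₂ = extend 375 460 540 refl (≤ᵇ⇒≤ _ _ tt) (room 1 (s≤s z≤n)) heavy₁ path₁
        w₃ , path₃ , heavy₃ = extend 460 560 440 refl (≤ᵇ⇒≤ _ _ tt) (room 2 (s≤s (s≤s z≤n))) heavy₂ path₂
        w₄ , path₄ , heavy₄ = extend 560 637 363 refl (≤ᵇ⇒≤ _ _ tt) (room 3 (s≤s (s≤s (s≤s z≤n)))) heavy₃ path₃
    in w₁ , w₂ , w₃ , w₄ , path₄ , heavy₄
    where
    room : ∀ k → k ≤ 3 → k + length (P ++ A) ≤ 12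
    room k k≤3 = +-mono-≤ k≤3 short

  bridge : ∀ {a b c d} (U : List (Fin n)) → length U ≤ 14 → Heavy H 637 a b → Heavy H 637 c d →
           Σ[ x ∈ Fin n ] Σ[ y ∈ Fin n ] All (x ≢_) U × All (y ≢_) U ×
             edge H a b x ≡ true × edge H c d y ≡ true × edge H b x y ≡ true × edge H d x y ≡ true
  bridge {a} {b} {c} {d} U short heavy-ab heavy-cd =
    let x , x-good  = sum-positive completions completions-positive
        y , found   = count-witness (λ y → X x ∧ K x y) x-good
        Xx , Kxy    = ∧-split found
        abx , x-U   = ∧-split Xx
        Yy , bdxy   = ∧-split Kxy
        cdy , y-U   = ∧-split Yy
        bxy , dxy   = ∧-split bdxy
    in x , y , outside⇒All≢ U x-U , outside⇒All≢ U y-U , abx , cdy , bxy , dxy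
    where
    open ≤-Reasoning
    X : Fin n → Bool
    X x = edge H a b x ∧ outside U x
    Y : Fin n → Bool
    Y y = edge H c d y ∧ outside U y
    K : Fin n → Fin n → Bool
    K x y = Y y ∧ (edge H b x y ∧ edge H d x y)
    completions : Fin n → ℕ
    completions x = count (λ y → X x ∧ K x y)
    pointwise : ∀ x → (if X x then count Y else 0) + (pdeg H b x + pdeg H d x) ≤ count (λ y → X x ∧ K x y) + (n + n)
    pointwise x with X x
    ... | true  = begin
      count Y + (pdeg H b x + pdeg H d x)                        ≤⟨ +-monoʳ-≤ (count Y) (count-∧ (edge H b x) (edge H d x)) ⟩
      count Y + (count (λ y → edge H b x y ∧ edge H d x y) + n)  ≡⟨ +-assoc (count Y) _ n ⟨
      count Y + count (λ y → edge H b x y ∧ edge H d x y) + n    ≤⟨ +-monoˡ-≤ n (count-∧ Y (λ y → edge H b x y ∧ edge H d x y)) ⟩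
      count (K x) + n + n                                        ≡⟨ +-assoc (count (K x)) n n ⟩
      count (K x) + (n + n)                                      ∎
    ... | false = ≤-trans (+-mono-≤ (count≤n (edge H b x)) (count≤n (edge H d x))) (m≤n+m (n + n) (count (λ y → false ∧ K x y)))
    summed : count X * count Y + (sum (pdeg H b) + sum (pdeg H d)) ≤ sum completions + n * (n + n)
    summed = begin
      count X * count Y + (sum (pdeg H b) + sum (pdeg H d))
        ≡⟨ cong₂ _+_ (sum-if X (count Y)) (∑-distrib-+ (pdeg H b) (pdeg H d)) ⟨
      sum (λ x → if X x then count Y else 0) + sum (λ x → pdeg H b x + pdeg H d x)
        ≡⟨ ∑-distrib-+ (λ x → if X x then count Y else 0) (λ x → pdeg H b x + pdeg H d x) ⟨
      sum (λ x → (if X x then count Y else 0) + (pdeg H b x + pdeg H d x)) ≤⟨ sum-mono-≤ pointwise ⟩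
      sum (λ x → completions x + (n + n))      ≡⟨ ∑-distrib-+ completions (λ _ → n + n) ⟩
      sum completions + sum {n} (λ _ → n + n)  ≡⟨ cong (sum completions +_) (sum-const {n} (n + n)) ⟩
      sum completions + n * (n + n)            ∎
    completions-positive : 0 < sum completions
    completions-positive = +-cancelʳ-< (n * (n + n)) 0 (sum completions) (begin-strict
      n * (n + n)
        <⟨ bridge-arithmetic {D₁ = sum (pdeg H b)} {D₂ = sum (pdeg H d)} n-large (count≤n X) (count≤n Y)
             (Heavy-outside H {637} {a} {b} U short heavy-ab) (Heavy-outside H {637} {c} {d} U short heavy-cd)
             (∑pdeg-lower-bound H δ b) (∑pdeg-lower-bound H δ d) ⟩
      count X * count Y + (sum (pdeg H b) + sum (pdeg H d)) ≤⟨ summed ⟩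
      sum completions + n * (n + n)                         ∎)

  connect : ∀ {a b c d L R} → PathAvoiding H (d ∷ c ∷ R) (b ∷ a ∷ L) → Consecutive H (b ∷ a ∷ L) →
            length ((d ∷ c ∷ R) ++ (b ∷ a ∷ L)) ≤ 14 → Heavy H 637 a b → Heavy H 637 c d →
            Σ[ x ∈ Fin n ] Σ[ y ∈ Fin n ] Unique (reverse (b ∷ a ∷ L) ++ x ∷ y ∷ d ∷ c ∷ R)
                                          × Consecutive H (reverse (b ∷ a ∷ L) ++ x ∷ y ∷ d ∷ c ∷ R)
  connect {a} {b} {c} {d} {L} {R} (pathAvoiding unique right) left short heavy-ab heavy-cd =
    let x , y , x-U , y-U , abx , cdy , bxy , dxy = bridge ((d ∷ c ∷ R) ++ (b ∷ a ∷ L)) short heavy-ab heavy-cd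
    in x , y
       , Unique-reverse-++ (b ∷ a ∷ L) (x ∷ y ∷ d ∷ c ∷ R) ((edge⇒≢ H bxy ∷ x-U) ∷ y-U ∷ unique)
       , Consecutive-reverse-++ H L (x ∷ y ∷ d ∷ c ∷ R) left
           (abx , bxy , trans (edge-rotate H x y d) dxy , trans (edge-reverse H y d c) cdy , right)

lemma3p3 : ∃ λ (n₀ : ℕ) → ∀ (n : ℕ) → n₀ ≤ n → (H : Graph3 n) → (∀ v → 799 * ((n ∸ 1) C 2) ≤ 1000 * vdeg H v) → (u₀ u₁ v₀ v₁ : Fin n) → u₀ ≢ u₁ → v₀ ≢ v₁ → 33 * (n ∸ 2) ≤ 100 * pdeg H u₀ u₁ → 33 * (n ∸ 2) ≤ 100 * pdeg H v₀ v₁ → u₀ ≢ v₀ → u₀ ≢ v₁ → u₁ ≢ v₀ → u₁ ≢ v₁ → Σ (List (Fin n)) λ mid → (length mid ≡ 10) × IsTightPath H (u₀ ∷ u₁ ∷ (mid ++ (v₁ ∷ v₀ ∷ [])))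
lemma3p3 = 100000 , λ n n-large H δ u₀ u₁ v₀ v₁ u₀≢u₁ v₀≢v₁ u-codegree v-codegree u₀≢v₀ u₀≢v₁ u₁≢v₀ u₁≢v₁ →
  let open Construction H δ n-large
      seed : PathAvoiding H (u₁ ∷ u₀ ∷ []) (v₁ ∷ v₀ ∷ [])
      seed = pathAvoiding ((≢-sym u₀≢u₁ ∷ u₁≢v₁ ∷ u₁≢v₀ ∷ []) ∷ (u₀≢v₁ ∷ u₀≢v₀ ∷ []) ∷ (≢-sym v₀≢v₁ ∷ []) ∷ [] ∷ []) tt
      w₁ , w₂ , w₃ , w₄ , left , w-heavy  = walk-to-heavy (≤ᵇ⇒≤ _ _ tt) (Heavy-from-codegree H u-codegree) seed
      z₁ , z₂ , z₃ , z₄ , right , z-heavy = walk-to-heavy (≤ᵇ⇒≤ _ _ tt) (Heavy-from-codegree H v-codegree) (PathAvoiding-swap H left)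
      x , y , unique , consecutive       = connect right (PathAvoiding.consecutive left) (≤ᵇ⇒≤ _ _ tt) w-heavy z-heavy
  in (w₁ ∷ w₂ ∷ w₃ ∷ w₄ ∷ x ∷ y ∷ z₄ ∷ z₃ ∷ z₂ ∷ z₁ ∷ []) , refl , s≤s (s≤s (s≤s z≤n)) , unique , consecutive
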